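{- Let $r\ge2$ and let $T_2=\begin{bmatrix}1&1\\0&1\end{bmatrix}$. Then $\mathrm{forb}(m,r,\mathrm{Sym}(T_2))=\Theta(m^{r-1})$.
   Context: An $r$-matrix is a matrix with entries in $\{0,1,\dots,r-1\}$; a matrix is simple if it has no repeated columns. $F\prec A$ means some submatrix of $A$ is a row and column permutation of $F$. $\mathrm{forb}(m,r,\mathcal F)$ is the maximum number of columns of a simple $m$-rowed $r$-matrix $A$ with $F\not\prec A$ for all $F\in\mathcal F$. For a $(0,1)$-matrix $F$, $F(i,j)$ replaces each $0$ by $i$ and each $1$ by $j$; $\mathrm{Sym}(F)=\{F(i,j):0\le i<j\le r-1\}$. Asymptotics are as $m\to\infty$ with $r$ fixed. -}

module Defs where

open import Data.Nat using (ℕ; zero; suc; _+_; _*_; _∸_; _^_; _≤_)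
open import Data.Fin using (Fin; zero; suc; _<_)
open import Data.Product using (Σ; ∃; _×_; _,_)
open import Relation.Binary.PropositionalEquality using (_≡_)
open import Relation.Nullary using (¬_)
open import Function.Definitions using (Injective)

Matrix : ℕ → ℕ → ℕ → Set
Matrix r m n = Fin m → Fin n → Fin r

Simple : ∀ {r m n} → Matrix r m n → Set
Simple {m = m} {n = n} A = ∀ (j j' : Fin n) → (∀ (i : Fin m) → A i j ≡ A i j') → j ≡ j'

-- F ≺ A: some submatrix of A is a row and column permutation of F,
-- i.e. there are injective row and column selections realising F.
_≺_ : ∀ {r p q m n} → Matrix r p q → Matrix r m n → Set
_≺_ {p = p} {q = q} {m = m} {n = n} F A =
  Σ (Fin p → Fin m) λ ρ → Σ (Fin q → Fin n) λ γ →
    Injective _≡_ _≡_ ρ × Injective _≡_ _≡_ γ ×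
    (∀ (i : Fin p) (j : Fin q) → A (ρ i) (γ j) ≡ F i j)

subst01 : ∀ {r p q} → Matrix 2 p q → Fin r → Fin r → Matrix r p q
subst01 F a b i j with F i j
... | zero  = a
... | suc _ = b

AvoidsSym : ∀ {r p q m n} → Matrix 2 p q → Matrix r m n → Set
AvoidsSym {r = r} F A = ∀ (a b : Fin r) → a < b → ¬ (subst01 F a b ≺ A)

IsForbSym : ℕ → (r : ℕ) → ∀ {p q} → Matrix 2 p q → ℕ → Set
IsForbSym m r F k =
  (Σ (Matrix r m k) λ A → Simple A × AvoidsSym F A) ×
  (∀ (n : ℕ) (A : Matrix r m n) → Simple A → AvoidsSym F A → n ≤ k)

T₂ : Matrix 2 2 2
T₂ zero    zero    = suc zero
T₂ zero    (suc _) = suc zero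
T₂ (suc _) zero    = zero
T₂ (suc _) (suc _) = suc zero

module Submission where

-- In a simple matrix avoiding Sym(T₂), record for every column j and
-- every nonzero value v one row where v occurs in j (or "none").  Two columns with the
-- same record are equal: if A i j' < A i j = v, the recorded row i₀ of v has v in both
-- columns, and rows (i₀, i), columns (j', j) form T₂(A i j', v).  Hence there are at
-- most (m + 1)^q ≤ 2^q m^q columns.
--
-- Split q⌊m/q⌋ rows into q blocks of t = ⌊m/q⌋ rows; for every choice
-- of one row per block take the column carrying v in the chosen row of block v and 0
-- elsewhere.  No nonzero value repeats in a column, so T₂(a, b) — whose second column repeats
-- b ≠ 0 — never occurs; this gives t^q ≥ m^q / (2q)^q columns.
--
-- Existence of forb.  Membership in the competing class is decidable (exhaustive
-- search over finite function spaces), so bounded maximisation below the upper bound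
-- produces the maximum k.

open import Defs
open import Data.Nat using (ℕ; zero; suc; _+_; _*_; _∸_; _^_; _≤_; z≤n; s≤s; >-nonZero)
open import Data.Nat.Properties
  using (≤-trans; ≤-reflexive; ≤-pred; ≤∧≢⇒<; <⇒≤; *-monoʳ-≤; +-monoˡ-≤;
         ^-monoˡ-≤; m≤n*m; *-comm; +-identityʳ; module ≤-Reasoning)
open import Data.Nat.DivMod using (_/_; _%_; m≡m%n+[m/n]*n; m%n<n; m/n*n≤m; m≥n⇒m/n>0)
open import Data.Nat.Tactic.RingSolver using (solve-∀)
open import Data.Fin using (Fin; zero; suc; _<_; finToFun; funToFin; combine; inject≤)
open import Data.Fin.Properties
  using (_≟_; _<?_; any?; all?; <-cmp; <-irrefl; injective⇒≤; inject≤-injective; combine-injective;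
         finToFun-funToFin; funToFin-finToFin)
open import Data.Vec.Functional using ([]; _∷_)
open import Data.Product using (Σ; ∃; _×_; _,_; proj₁; proj₂)
open import Function using (_∘_)
open import Function.Definitions using (Injective)
open import Relation.Binary using (tri<; tri≈; tri>)
open import Relation.Binary.PropositionalEquality
  using (_≡_; _≢_; _≗_; refl; sym; trans; cong; cong₂)
open import Relation.Nullary using (Dec; yes; no; ¬_; contradiction)
open import Relation.Nullary.Decidable using (map′; _×-dec_; _→-dec_; ¬?)
open import Relation.Unary using (Decidable)

_≋_ : ∀ {r m n} → Matrix r m n → Matrix r m n → Set
A ≋ B = ∀ i j → A i j ≡ B i j

Extensional : ∀ {k s} → ((Fin k → Fin s) → Set) → Set
Extensional P = ∀ {f g} → f ≗ g → P f → P g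

funToFin-cong : ∀ {k s} {f g : Fin k → Fin s} → f ≗ g → funToFin f ≡ funToFin g
funToFin-cong {zero}  f≗g = refl
funToFin-cong {suc k} f≗g = cong₂ combine (f≗g zero) (funToFin-cong (f≗g ∘ suc))

funToFin-injective : ∀ {k s} {f g : Fin k → Fin s} → funToFin f ≡ funToFin g → f ≗ g
funToFin-injective {f = f} {g} e i =
  trans (sym (finToFun-funToFin f i)) (trans (cong (λ c → finToFun c i) e) (finToFun-funToFin g i))

finToFun-injective : ∀ {k s} {c c' : Fin (s ^ k)} → finToFun {s} {k} c ≗ finToFun c' → c ≡ c'
finToFun-injective {k} {s} {c} {c'} e =
  trans (sym (funToFin-finToFin {k} {s} c)) (trans (funToFin-cong {f = finToFun c} {finToFun c'} e)
    (funToFin-finToFin {k} {s} c'))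

injective-resp : ∀ {a b} {f g : Fin a → Fin b} → f ≗ g → Injective _≡_ _≡_ f → Injective _≡_ _≡_ g
injective-resp f≗g inj {x} {y} gx≡gy = inj (trans (f≗g x) (trans gx≡gy (sym (f≗g y))))

searchFun : ∀ {k s} (P : (Fin k → Fin s) → Set) → Extensional P → Decidable P → Dec (∃ P)
searchFun P ext P? with any? (P? ∘ finToFun)
... | yes (c , p) = yes (finToFun c , p)
... | no none     = no λ (f , p) → none (funToFin f , ext (λ i → sym (finToFun-funToFin f i)) p)

searchMatrix : ∀ {r m n} (P : Matrix r m n → Set) → (∀ {A B} → A ≋ B → P A → P B) →
               Decidable P → Dec (∃ P)
searchMatrix {r} {m} {n} P resp P? =
  map′ (λ (ρ , p) → decode ρ , p) encode (searchFun (P ∘ decode) decode-resp (P? ∘ decode))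
  where
    decode : (Fin m → Fin (r ^ n)) → Matrix r m n
    decode ρ i = finToFun (ρ i)
    decode-resp : Extensional (P ∘ decode)
    decode-resp e = resp (λ i j → cong (λ c → finToFun c j) (e i))
    encode : ∃ P → ∃ (P ∘ decode)
    encode (A , p) = funToFin ∘ A , resp (λ i j → sym (finToFun-funToFin (A i) j)) p

injective? : ∀ {a b} (f : Fin a → Fin b) → Dec (Injective _≡_ _≡_ f)
injective? f = map′ (λ h {x} {y} → h x y) (λ h x y → h)
  (all? λ x → all? λ y → (f x ≟ f y) →-dec (x ≟ y))

_≺?_ : ∀ {r p q m n} (F : Matrix r p q) (A : Matrix r m n) → Dec (F ≺ A)
_≺?_ {p = p} {q} {m} {n} F A = searchFun (∃ ∘ Embeds) rows-resp λ ρ →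
  searchFun (Embeds ρ) (cols-resp ρ) λ γ →
    injective? ρ ×-dec injective? γ ×-dec all? λ i → all? λ j → A (ρ i) (γ j) ≟ F i j
  where
    Embeds : (Fin p → Fin m) → (Fin q → Fin n) → Set
    Embeds ρ γ = Injective _≡_ _≡_ ρ × Injective _≡_ _≡_ γ × (∀ i j → A (ρ i) (γ j) ≡ F i j)
    cols-resp : ∀ ρ → Extensional (Embeds ρ)
    cols-resp ρ e (ρ-inj , γ-inj , at) =
      ρ-inj , injective-resp e γ-inj , λ i j → trans (cong (A (ρ i)) (sym (e j))) (at i j)
    rows-resp : Extensional (∃ ∘ Embeds)
    rows-resp e (γ , ρ-inj , γ-inj , at) =
      γ , injective-resp e ρ-inj , γ-inj , λ i j → trans (cong (λ x → A x (γ j)) (sym (e i))) (at i j)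

≺-resp : ∀ {r p q m n} {F : Matrix r p q} {A B : Matrix r m n} → A ≋ B → F ≺ A → F ≺ B
≺-resp A≋B (ρ , γ , ρ-inj , γ-inj , at) = ρ , γ , ρ-inj , γ-inj , λ i j → trans (sym (A≋B _ _)) (at i j)

Admissible : ∀ r m {p q} → Matrix 2 p q → ℕ → Set
Admissible r m F n = Σ (Matrix r m n) λ A → Simple A × AvoidsSym F A

admissible? : ∀ r m {p q} (F : Matrix 2 p q) → Decidable (Admissible r m F)
admissible? r m F n = searchMatrix _ resp λ A → simple? A ×-dec avoids? A
  where
    simple? : (A : Matrix r m n) → Dec (Simple A)
    simple? A = all? λ j → all? λ j' → all? (λ i → A i j ≟ A i j') →-dec (j ≟ j')
    avoids? : (A : Matrix r m n) → Dec (AvoidsSym F A)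
    avoids? A = all? λ a → all? λ b → (a <? b) →-dec ¬? (subst01 F a b ≺? A)
    resp : ∀ {A B} → A ≋ B → Simple A × AvoidsSym F A → Simple B × AvoidsSym F B
    resp A≋B (simple , avoids) =
      (λ j j' agree → simple j j' λ i → trans (A≋B i j) (trans (agree i) (sym (A≋B i j')))) ,
      (λ a b a<b contained → avoids a b a<b (≺-resp (λ i j → sym (A≋B i j)) contained))

largestUpTo : (P : ℕ → Set) → Decidable P → P 0 → ∀ b →
              ∃ λ k → P k × (∀ n → P n → n ≤ b → n ≤ k)
largestUpTo P P? p0 zero = 0 , p0 , λ _ _ n≤0 → n≤0
largestUpTo P P? p0 (suc b) with P? (suc b) | largestUpTo P P? p0 b
... | yes p  | _               = suc b , p , λ _ _ n≤b+1 → n≤b+1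
... | no ¬p  | k , pk , below  = k , pk , λ n pn n≤b+1 →
  below n pn (≤-pred (≤∧≢⇒< n≤b+1 λ { refl → ¬p pn }))

-- forb(m, r, Sym(F)) exists as soon as the admissible matrices have boundedly many columns
-- (F needs a column so that the empty matrix is admissible).
forb-exists : ∀ m r {p q} (F : Matrix 2 p (suc q)) b →
              (∀ n (A : Matrix r m n) → Simple A → AvoidsSym F A → n ≤ b) →
              ∃ λ k → IsForbSym m r F k
forb-exists m r F b bounded with largestUpTo (Admissible r m F) (admissible? r m F) empty b
  where
    empty : Admissible r m F 0
    empty = (λ _ ()) , (λ ()) , λ { _ _ _ (_ , γ , _) → contradiction (γ zero) λ () }
... | k , admissible , largest =
  k , admissible , λ n A simple avoids → largest n (A , simple , avoids) (bounded n A simple avoids)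

pair-injective : ∀ {m} {x y : Fin m} → x ≢ y → Injective _≡_ _≡_ (x ∷ y ∷ [])
pair-injective x≢y {zero}     {zero}     _ = refl
pair-injective x≢y {zero}     {suc zero} e = contradiction e x≢y
pair-injective x≢y {suc zero} {zero}     e = contradiction (sym e) x≢y
pair-injective x≢y {suc zero} {suc zero} _ = refl

module UpperBound {q m n} (A : Matrix (suc q) m n) (simple : Simple A) (avoids : AvoidsSym T₂ A) where

  occurrence : Fin n → Fin q → Fin (suc m)
  occurrence j u with any? (λ i → A i j ≟ suc u)
  ... | yes (i , _) = suc i
  ... | no _        = zero

  occurrence-located : ∀ {j u i₀} → occurrence j u ≡ suc i₀ → A i₀ j ≡ suc u
  occurrence-located {j} {u} e with any? (λ i → A i j ≟ suc u) | e
  ... | yes (_ , hit) | refl = hit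

  occurrence-found : ∀ {j u i} → A i j ≡ suc u → ∃ λ i₀ → occurrence j u ≡ suc i₀
  occurrence-found {j} {u} {i} hit with any? (λ i → A i j ≟ suc u)
  ... | yes (i₀ , _) = i₀ , refl
  ... | no none      = contradiction (i , hit) none

  notBelow : ∀ {j j'} → occurrence j ≗ occurrence j' → ∀ i → ¬ (A i j' < A i j)
  notBelow {j} {j'} same i below with A i j in hit
  ... | suc u with occurrence-found hit
  ... | i₀ , found = avoids (A i j') (suc u) below
    ((i₀ ∷ i ∷ []) , (j' ∷ j ∷ []) , pair-injective i₀≢i , pair-injective j'≢j , entries)
    where
      hit₀ : A i₀ j ≡ suc u
      hit₀ = occurrence-located found
      hit₀' : A i₀ j' ≡ suc u
      hit₀' = occurrence-located (trans (sym (same u)) found)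
      i₀≢i : i₀ ≢ i
      i₀≢i refl = <-irrefl hit₀' below
      j'≢j : j' ≢ j
      j'≢j refl = <-irrefl hit below
      entries : ∀ a b → A ((i₀ ∷ i ∷ []) a) ((j' ∷ j ∷ []) b) ≡ subst01 T₂ (A i j') (suc u) a b
      entries zero       zero       = hit₀'
      entries zero       (suc zero) = hit₀
      entries (suc zero) zero       = refl
      entries (suc zero) (suc zero) = hit

  columnsAgree : ∀ {j j'} → occurrence j ≗ occurrence j' → ∀ i → A i j ≡ A i j'
  columnsAgree {j} {j'} same i with <-cmp (A i j) (A i j')
  ... | tri< above _ _ = contradiction above (notBelow (sym ∘ same) i)
  ... | tri≈ _ equal _ = equal
  ... | tri> _ _ below = contradiction below (notBelow same i)

  columnBound : n ≤ suc m ^ q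
  columnBound = injective⇒≤ {f = funToFin ∘ occurrence}
    λ e → simple _ _ (columnsAgree (funToFin-injective e))

module Construction (q t m : ℕ) (qt≤m : q * t ≤ m) where

  -- Column c chooses one of the t rows of each block v, and carries v + 1 exactly there.
  choice : Fin (t ^ q) → Fin q → Fin t
  choice = finToFun

  position : Fin (t ^ q) → Fin q → Fin m
  position c v = inject≤ (combine v (choice c v)) qt≤m

  position-injective : ∀ {c c' v v'} → position c v ≡ position c' v' →
                       v ≡ v' × choice c v ≡ choice c' v'
  position-injective e = combine-injective _ _ _ _ (inject≤-injective _ _ _ _ e)

  C : Matrix (suc q) m (t ^ q)
  C i c with any? (λ v → position c v ≟ i)
  ... | yes (v , _) = suc v
  ... | no _        = zero

  C-at-position : ∀ c v → C (position c v) c ≡ suc v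
  C-at-position c v with any? (λ v' → position c v' ≟ position c v)
  ... | yes (v' , e) = cong suc (proj₁ (position-injective e))
  ... | no none      = contradiction (v , refl) none

  C-value : ∀ {i c v} → C i c ≡ suc v → position c v ≡ i
  C-value {i} {c} e with any? (λ v → position c v ≟ i) | e
  ... | yes (_ , at) | refl = at

  simpleC : Simple C
  simpleC c c' agree = finToFun-injective {q} {t} λ v →
    sym (proj₂ (position-injective (C-value (trans (sym (agree (position c v))) (C-at-position c v)))))

  -- T₂(a, b) repeats b ≠ 0 in its second column, but no nonzero value repeats in a column of C.
  avoidsC : AvoidsSym T₂ C
  avoidsC _ (suc v) _ (ρ , γ , ρ-inj , _ , entries) with
    ρ-inj (trans (sym (C-value (entries zero (suc zero)))) (C-value (entries (suc zero) (suc zero))))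
  ... | ()

*-^-distrib : ∀ x y n → (x * y) ^ n ≡ x ^ n * y ^ n
*-^-distrib x y zero    = refl
*-^-distrib x y (suc n) = trans (cong ((x * y) *_) (*-^-distrib x y n)) (interchange x y (x ^ n) (y ^ n))
  where
    interchange : ∀ a b c d → (a * b) * (c * d) ≡ (a * c) * (b * d)
    interchange = solve-∀

^-bound : ∀ {x} c y n → x ≤ c * y → x ^ n ≤ c ^ n * y ^ n
^-bound c y n x≤cy = ≤-trans (^-monoˡ-≤ n x≤cy) (≤-reflexive (*-^-distrib c y n))

suc≤2* : ∀ {m} → 1 ≤ m → suc m ≤ 2 * m
suc≤2* {m} 1≤m = ≤-trans (+-monoˡ-≤ m 1≤m) (≤-reflexive (cong (m +_) (sym (+-identityʳ m))))

-- For m ≥ q ≥ 1, m ≤ 2q ⌊m/q⌋ (the remainder is below q ≤ q ⌊m/q⌋).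
≤2q*quotient : ∀ {q m} → suc q ≤ m → m ≤ (2 * suc q) * (m / suc q)
≤2q*quotient {q} {m} q≤m = begin
  m                      ≡⟨ m≡m%n+[m/n]*n m (suc q) ⟩
  m % suc q + t * suc q  ≤⟨ +-monoˡ-≤ (t * suc q) (≤-trans (<⇒≤ (m%n<n m (suc q))) q≤tq) ⟩
  t * suc q + t * suc q  ≡⟨ double t (suc q) ⟩
  (2 * suc q) * t        ∎
  where
    open ≤-Reasoning
    t = m / suc q
    q≤tq : suc q ≤ t * suc q
    q≤tq = m≤n*m (suc q) t {{>-nonZero (m≥n⇒m/n>0 q≤m)}}
    double : ∀ a b → a * b + a * b ≡ (2 * b) * a
    double = solve-∀

mainTheorem4 : (r : ℕ) → 2 ≤ r →
    Σ ℕ λ a → Σ ℕ λ b → Σ ℕ λ M → ∀ (m : ℕ) → M ≤ m →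
    Σ ℕ λ k → IsForbSym m r T₂ k × m ^ (r ∸ 1) ≤ a * k × k ≤ b * m ^ (r ∸ 1)
mainTheorem4 .(suc (suc p)) (s≤s (s≤s {n = p} _)) = (2 * q) ^ q , 2 ^ q , q , bounds
  where
    q = suc p
    bounds : ∀ m → q ≤ m → Σ ℕ λ k → IsForbSym m (suc q) T₂ k × m ^ q ≤ (2 * q) ^ q * k × k ≤ 2 ^ q * m ^ q
    bounds m q≤m with forb-exists m (suc q) T₂ (suc m ^ q)
                 (λ _ → UpperBound.columnBound)
    ... | k , forb@((A , simple , avoids) , maximal) = k , forb , lower , upper
      where
        t = m / q
        open Construction q t m (≤-trans (≤-reflexive (*-comm q t)) (m/n*n≤m m q))
        lower : m ^ q ≤ (2 * q) ^ q * k
        lower = ≤-trans (^-bound (2 * q) t q (≤2q*quotient q≤m))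
                  (*-monoʳ-≤ ((2 * q) ^ q) (maximal (t ^ q) C simpleC avoidsC))
        upper : k ≤ 2 ^ q * m ^ q
        upper = ≤-trans (UpperBound.columnBound A simple avoids)
                  (^-bound 2 m q (suc≤2* (≤-trans (s≤s z≤n) q≤m)))
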